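{- Let $n\ge 1$ and let $T\in\mathcal{T}_n$. Let $\varphi(T)$ be the sequence obtained by traversing the edges of $T$ in a depth-first walk from left to right (start at the root, go to the leftmost child and explore that branch recursively, return to the root, continue to the next child, and so on), recording the label of each edge every time it is traversed (so each edge label is recorded twice, once in each direction). Then $\varphi(T)$ is a quasi-Stirling permutation and $\operatorname{des}(\varphi(T))=\operatorname{cdes}(T)$. (The map $\varphi:\mathcal{T}_n\to\overline{\mathcal{Q}}_n$ is a bijection.)
   Context: For a sequence $\pi=\pi_1\cdots\pi_r$ of positive integers, $i\in[r]=\{1,\dots,r\}$ is a descent if $\pi_i>\pi_{i+1}$ or $i=r$, and $\operatorname{des}(\pi)$ is the number of descents. The number of cyclic descents is $\operatorname{cdes}(\pi)=|\{i\in[r]:\pi_i>\pi_{i+1}\}|$ with the convention $\pi_{r+1}:=\pi_1$. A quasi-Stirling permutation of size $n$ is a permutation $\pi_1\cdots\pi_{2n}$ of the multiset $\{1,1,2,2,\dots,n,n\}$ for which there are no indices $i<j<k<\ell$ with $\pi_i=\pi_k$ and $\pi_j=\pi_\ell$; $\overline{\mathcal{Q}}_n$ denotes their set. $\mathcal{T}_n$ is the set of plane (ordered) rooted trees with $n$ edges whose edges are labeled bijectively by $[n]$. For a vertex $v$ of $T\in\mathcal{T}_n$ whose edges to its children have labels $a_1,\dots,a_d$ from left to right: if $v$ is not the root and the edge to its parent has label $\ell$, then $\operatorname{cdes}(v)=\operatorname{cdes}(\ell a_1\cdots a_d)$; if $v$ is the root, $\operatorname{cdes}(v)=\operatorname{des}(a_1\cdots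 a_d)$. Finally $\operatorname{cdes}(T)=\sum_v\operatorname{cdes}(v)$ over all vertices $v$ of $T$. -}

module Defs where

open import Data.Nat using (ℕ; zero; suc; _+_; _<_; _<?_)
open import Data.Product using (_×_; _,_; proj₁; proj₂; ∃-syntax)
open import Data.List using (List; []; _∷_; _++_; [_]; map; concatMap; upTo; length; lookup; take)
open import Data.List.Relation.Binary.Permutation.Propositional using (_↭_)
open import Data.Fin as Fin using (Fin)
open import Relation.Binary.PropositionalEquality using (_≡_)
open import Relation.Nullary using (¬_)
open import Relation.Nullary.Decidable using (does)
open import Data.Bool using (if_then_else_)
open import Data.Empty using (⊥)

range : ℕ → List ℕ
range n = map suc (upTo n)

adjDes : List ℕ → ℕ
adjDes [] = 0
adjDes (x ∷ []) = 0
adjDes (x ∷ y ∷ r) = (if does (y <? x) then 1 else 0) + adjDes (y ∷ r)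

-- des(π): i is a descent if π_i > π_{i+1} or i = r
des : List ℕ → ℕ
des [] = 0
des (x ∷ r) = adjDes (x ∷ r) + 1

-- cdes(π): descents with the cyclic convention π_{r+1} := π_1
cdes : List ℕ → ℕ
cdes π = adjDes (π ++ take 1 π)

doubled : ℕ → List ℕ
doubled n = concatMap (λ i → i ∷ i ∷ []) (range n)

NoCrossing : List ℕ → Set
NoCrossing π = (i j k l : Fin (length π)) → i Fin.< j → j Fin.< k → k Fin.< l →
  lookup π i ≡ lookup π k → lookup π j ≡ lookup π l → ⊥

QuasiStirling : ℕ → List ℕ → Set
QuasiStirling n π = (π ↭ doubled n) × NoCrossing π

-- Plane rooted trees with labelled edges.
-- A vertex is given by the ordered list of (edge label, child subtree)
-- for its children, from left to right.
data Tree : Set where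
  node : List (ℕ × Tree) → Tree

mutual
  labels : Tree → List ℕ
  labels (node cs) = labelsF cs

  labelsF : List (ℕ × Tree) → List ℕ
  labelsF [] = []
  labelsF ((a , t) ∷ cs) = a ∷ labels t ++ labelsF cs

-- T ∈ 𝒯_n : the edges are labelled bijectively by [n]
-- (the label list, one entry per edge, is a permutation of 1,…,n)
InT : ℕ → Tree → Set
InT n T = labels T ↭ range n

mutual
  φ : Tree → List ℕ
  φ (node cs) = φF cs

  φF : List (ℕ × Tree) → List ℕ
  φF [] = []
  φF ((a , t) ∷ cs) = (a ∷ φ t ++ [ a ]) ++ φF cs

childLabels : Tree → List ℕ
childLabels (node cs) = map proj₁ cs

mutual
  -- contribution of all non-root vertices below a list of child edges
  cdesF : List (ℕ × Tree) → ℕ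
  cdesF [] = 0
  cdesF ((ℓ , node ds) ∷ cs) = cdes (ℓ ∷ map proj₁ ds) + cdesF ds + cdesF cs

cdesT : Tree → ℕ
cdesT (node cs) = des (map proj₁ cs) + cdesF cs

-- The word φ(T) is the concatenation, over the children of the root, of excursions a φ(t) a.
-- Since the labels are distinct, different excursions use disjoint letters, and an excursion
-- a w a is crossing-free when w is, so φ(T) is quasi-Stirling. Cutting the
-- adjacent pairs of φ(T) at the closing letter of every excursion distributes them over the
-- vertices: a non-root vertex with parent edge ℓ and child labels a₁⋯a_d sees exactly the
-- word ℓ a₁ ⋯ a_d ℓ, i.e. its cyclic descents, and the root sees its child labels.
-- Conversely, in a quasi-Stirling word a ρ the first letter recurs exactly once, ρ = w a v,
-- and no letter can occur both in w and in v without crossing a; so w and v are again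
-- quasi-Stirling and recursion inverts φ. The split point is forced, which gives injectivity.
module Submission where

open import Defs
open import Data.Bool using (if_then_else_)
open import Data.Empty using (⊥; ⊥-elim)
open import Data.Fin as Fin using (Fin; toℕ)
open import Data.List using (List; []; _∷_; _++_; [_]; map; length; lookup; drop; concatMap)
open import Data.List.Properties using (++-assoc; ++-identityʳ; ∷-injective; ∷-injectiveˡ; ∷-injectiveʳ)
open import Data.List.Relation.Binary.Permutation.Propositional as ↭ using (_↭_; prep; swap)
open import Data.List.Relation.Binary.Permutation.Propositional.Properties using (shift)
open import Data.List.Relation.Binary.Sublist.Propositional
  using (_⊆_; []; _∷_; _∷ʳ_; ⊆-refl; ⊆-trans; minimum)
open import Data.List.Relation.Binary.Sublist.Propositional.Properties
  using (++⁺; ++⁺ˡ; ++⁺ʳ; length-mono-≤)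
open import Data.List.Relation.Unary.All using (All; []; _∷_)
open import Data.List.Relation.Unary.AllPairs using ([]; _∷_)
open import Data.List.Relation.Unary.Unique.Propositional using (Unique)
open import Data.List.Relation.Unary.Unique.Propositional.Properties using (upTo⁺; map⁺)
open import Data.Nat using (ℕ; zero; suc; _+_; _*_; _≤_; z≤n; s≤s; _≟_; _<?_)
open import Data.Nat.Properties
  using ( +-assoc; +-identityʳ; +-cancelˡ-≡; *-distribˡ-+; *-cancelˡ-≡; +-monoʳ-≤; +-monoˡ-≤
        ; m≤m+n; m≤n+m; m+n≤o⇒n≤o; n≤0⇒n≡0; m+n≡0⇒n≡0; ≤-pred; ≤-trans; ≤-refl; suc-injective)
open import Data.Nat.Tactic.RingSolver using (solve-∀)
open import Data.Product using (_×_; _,_; ∃-syntax; ∃₂; proj₁; proj₂)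
open import Data.Sum using (_⊎_; inj₁; inj₂)
open import Data.Unit using (⊤; tt)
open import Function using (_∘_)
open import Relation.Binary.PropositionalEquality hiding ([_])
open import Relation.Nullary using (¬_; does; yes; no)
open import Relation.Nullary.Decidable using (dec-true; dec-false)

count : ℕ → List ℕ → ℕ
count x [] = 0
count x (y ∷ ys) = (if does (x ≟ y) then 1 else 0) + count x ys

count-here : ∀ x ys → count x (x ∷ ys) ≡ suc (count x ys)
count-here x ys rewrite dec-true (x ≟ x) refl = refl

count-there : ∀ {x y} ys → x ≢ y → count x (y ∷ ys) ≡ count x ys
count-there {x} {y} ys x≢y rewrite dec-false (x ≟ y) x≢y = refl

count-++ : ∀ x xs ys → count x (xs ++ ys) ≡ count x xs + count x ys
count-++ x [] ys = refl
count-++ x (y ∷ xs) ys rewrite count-++ x xs ys = sym (+-assoc _ (count x xs) (count x ys))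

count-resp-↭ : ∀ {xs ys} → xs ↭ ys → ∀ x → count x xs ≡ count x ys
count-resp-↭ ↭.refl x = refl
count-resp-↭ (prep y p) x = cong (_ +_) (count-resp-↭ p x)
count-resp-↭ (swap y z p) x =
  trans (cong (λ c → δ y + (δ z + c)) (count-resp-↭ p x)) (left-comm (δ y) (δ z) _)
  where
  δ : ℕ → ℕ
  δ w = if does (x ≟ w) then 1 else 0
  left-comm : ∀ a b c → a + (b + c) ≡ b + (a + c)
  left-comm = solve-∀
count-resp-↭ (↭.trans p q) x = trans (count-resp-↭ p x) (count-resp-↭ q x)

split-at-first : ∀ x ys → 1 ≤ count x ys → ∃₂ λ u v → ys ≡ u ++ x ∷ v × count x u ≡ 0
split-at-first x (y ∷ ys) x∈ys with x ≟ y
... | yes refl = [] , ys , refl , refl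
... | no x≢y with split-at-first x ys (subst (1 ≤_) (count-there ys x≢y) x∈ys)
...   | u , v , refl , x∉u = y ∷ u , v , refl , trans (count-there u x≢y) x∉u

count-≡⇒↭ : ∀ xs ys → (∀ x → count x xs ≡ count x ys) → xs ↭ ys
count-≡⇒↭ [] [] _ = ↭.refl
count-≡⇒↭ [] (y ∷ ys) same with trans (same y) (count-here y ys)
... | ()
count-≡⇒↭ (x ∷ xs) ys same
  with split-at-first x ys (subst (1 ≤_) (trans (sym (count-here x xs)) (same x)) (s≤s z≤n))
... | u , v , refl , _ = ↭.trans (prep x (count-≡⇒↭ xs (u ++ v) same′)) (↭.↭-sym (shift x u v))
  where
  same′ : ∀ z → count z xs ≡ count z (u ++ v)
  same′ z = +-cancelˡ-≡ _ _ _ (trans (same z) (count-resp-↭ (shift x u v) z))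

double : List ℕ → List ℕ
double = concatMap (λ i → i ∷ i ∷ [])

count-double : ∀ x L → count x (double L) ≡ 2 * count x L
count-double x [] = refl
count-double x (y ∷ L) rewrite count-double x L = distrib (if does (x ≟ y) then 1 else 0) (count x L)
  where
  distrib : ∀ i c → i + (i + 2 * c) ≡ 2 * (i + c)
  distrib = solve-∀

mutual
  count-φ : ∀ x T → count x (φ T) ≡ 2 * count x (labels T)
  count-φ x (node cs) = count-φF x cs

  count-φF : ∀ x cs → count x (φF cs) ≡ 2 * count x (labelsF cs)
  count-φF x [] = refl
  count-φF x ((a , t) ∷ cs) = begin
    count x ((a ∷ φ t ++ [ a ]) ++ φF cs)
      ≡⟨ count-++ x (a ∷ φ t ++ [ a ]) (φF cs) ⟩
    count x (a ∷ φ t ++ [ a ]) + count x (φF cs)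
      ≡⟨ cong₂ _+_ (count-excursion x a t) (count-φF x cs) ⟩
    2 * count x (a ∷ labels t) + 2 * count x (labelsF cs)
      ≡⟨ sym (*-distribˡ-+ 2 (count x (a ∷ labels t)) (count x (labelsF cs))) ⟩
    2 * (count x (a ∷ labels t) + count x (labelsF cs))
      ≡⟨ cong (2 *_) (sym (count-++ x (a ∷ labels t) (labelsF cs))) ⟩
    2 * count x (labelsF ((a , t) ∷ cs)) ∎
    where open ≡-Reasoning

  count-excursion : ∀ x a t → count x (a ∷ φ t ++ [ a ]) ≡ 2 * count x (a ∷ labels t)
  count-excursion x a t rewrite count-++ x (φ t) [ a ] | count-φ x t
    = distrib (if does (x ≟ a) then 1 else 0) (count x (labels t))
    where
    distrib : ∀ i c → i + (2 * c + (i + 0)) ≡ 2 * (i + c)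
    distrib = solve-∀

Distinct : List ℕ → Set
Distinct xs = ∀ x → count x xs ≤ 1

Disjoint : List ℕ → List ℕ → Set
Disjoint u v = ∀ x → 1 ≤ count x u → count x v ≡ 0

count-absent : ∀ {x xs} → All (x ≢_) xs → count x xs ≡ 0
count-absent [] = refl
count-absent {xs = _ ∷ xs} (x≢y ∷ x∉xs) = trans (count-there xs x≢y) (count-absent x∉xs)

Unique⇒Distinct : ∀ {xs} → Unique xs → Distinct xs
Unique⇒Distinct [] x = z≤n
Unique⇒Distinct {y ∷ xs} (y∉xs ∷ unique) x with x ≟ y
... | yes refl = subst (_≤ 1) (sym (trans (count-here x xs) (cong suc (count-absent y∉xs)))) ≤-refl
... | no x≢y = subst (_≤ 1) (sym (count-there xs x≢y)) (Unique⇒Distinct unique x)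

Distinct-range : ∀ n → Distinct (range n)
Distinct-range n = Unique⇒Distinct (map⁺ suc-injective (upTo⁺ n))

Distinct-resp-↭ : ∀ {xs ys} → xs ↭ ys → Distinct ys → Distinct xs
Distinct-resp-↭ p d x = subst (_≤ 1) (sym (count-resp-↭ p x)) (d x)

Distinct-++⁻ : ∀ xs ys → Distinct (xs ++ ys) → Distinct xs × Distinct ys × Disjoint xs ys
Distinct-++⁻ xs ys d = distinct-xs , distinct-ys , disjoint
  where
  bound : ∀ x → count x xs + count x ys ≤ 1
  bound x = subst (_≤ 1) (count-++ x xs ys) (d x)
  distinct-xs : Distinct xs
  distinct-xs x = ≤-trans (m≤m+n (count x xs) _) (bound x)
  distinct-ys : Distinct ys
  distinct-ys x = m+n≤o⇒n≤o (count x xs) (bound x)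
  disjoint : Disjoint xs ys
  disjoint x pos = n≤0⇒n≡0 (≤-pred (≤-trans (+-monoˡ-≤ _ pos) (bound x)))

Distinct-∷⁻ : ∀ x xs → Distinct (x ∷ xs) → count x xs ≡ 0 × Distinct xs
Distinct-∷⁻ x xs d with Distinct-++⁻ [ x ] xs d
... | _ , distinct-xs , disjoint = disjoint x (subst (1 ≤_) (sym (count-here x [])) ≤-refl) , distinct-xs

positive-half : ∀ c → 1 ≤ 2 * c → 1 ≤ c
positive-half zero ()
positive-half (suc c) _ = s≤s z≤n

Disjoint-double : ∀ {u v u′ v′} →
  (∀ x → count x u′ ≡ 2 * count x u) → (∀ x → count x v′ ≡ 2 * count x v) →
  Disjoint u v → Disjoint u′ v′
Disjoint-double {u} count-u′ count-v′ disjoint x pos =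
  trans (count-v′ x) (cong (2 *_) (disjoint x x∈u))
  where
  x∈u : 1 ≤ count x u
  x∈u = positive-half (count x u) (subst (1 ≤_) (count-u′ x) pos)

Cross : List ℕ → Set
Cross π = ∃₂ λ x y → x ∷ y ∷ x ∷ y ∷ [] ⊆ π

count-mono-⊆ : ∀ {xs ys} → xs ⊆ ys → ∀ x → count x xs ≤ count x ys
count-mono-⊆ [] x = z≤n
count-mono-⊆ (y ∷ʳ h) x = ≤-trans (count-mono-⊆ h x) (m≤n+m _ _)
count-mono-⊆ (refl ∷ h) x = +-monoʳ-≤ _ (count-mono-⊆ h x)

[x]⊆⇒count-pos : ∀ {x u} → [ x ] ⊆ u → 1 ≤ count x u
[x]⊆⇒count-pos {x} {u} h = subst (_≤ count x u) (count-here x []) (count-mono-⊆ h x)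

count-pos⇒[x]⊆ : ∀ x u → 1 ≤ count x u → [ x ] ⊆ u
count-pos⇒[x]⊆ x u pos with split-at-first x u pos
... | w , v , refl , _ = ++⁺ˡ w (refl ∷ minimum v)

⊆-++-split : ∀ (u v : List ℕ) {xs} → xs ⊆ u ++ v → ∃₂ λ p s → xs ≡ p ++ s × p ⊆ u × s ⊆ v
⊆-++-split [] v h = [] , _ , refl , [] , h
⊆-++-split (y ∷ u) v (.y ∷ʳ h) with ⊆-++-split u v h
... | p , s , refl , p⊆u , s⊆v = p , s , refl , y ∷ʳ p⊆u , s⊆v
⊆-++-split (y ∷ u) v (refl ∷ h) with ⊆-++-split u v h
... | p , s , refl , p⊆u , s⊆v = y ∷ p , s , refl , refl ∷ p⊆u , s⊆v

Disjoint⇒¬common : ∀ {u v z} → Disjoint u v → [ z ] ⊆ u → [ z ] ⊆ v → ⊥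
Disjoint⇒¬common {z = z} disjoint z∈u z∈v
  with subst (1 ≤_) (disjoint z ([x]⊆⇒count-pos z∈u)) ([x]⊆⇒count-pos z∈v)
... | ()

-- A proper split of the word x y x y leaves some letter on both sides.
noCross-++ : ∀ u v → Disjoint u v → ¬ Cross u → ¬ Cross v → ¬ Cross (u ++ v)
noCross-++ u v disjoint no-u no-v (x , y , h) with ⊆-++-split u v h
... | [] , _ , refl , _ , s⊆v = no-v (x , y , s⊆v)
... | _ ∷ [] , _ , refl , p⊆u , s⊆v =
  Disjoint⇒¬common disjoint p⊆u (⊆-trans (y ∷ʳ refl ∷ y ∷ʳ []) s⊆v)
... | _ ∷ _ ∷ [] , _ , refl , p⊆u , s⊆v =
  Disjoint⇒¬common disjoint (⊆-trans (refl ∷ y ∷ʳ []) p⊆u) (⊆-trans (refl ∷ y ∷ʳ []) s⊆v)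
... | _ ∷ _ ∷ _ ∷ [] , _ , refl , p⊆u , s⊆v =
  Disjoint⇒¬common disjoint (⊆-trans (x ∷ʳ refl ∷ x ∷ʳ []) p⊆u) s⊆v
... | _ ∷ _ ∷ _ ∷ _ ∷ [] , [] , refl , p⊆u , _ = no-u (x , y , p⊆u)
... | _ ∷ _ ∷ _ ∷ _ ∷ [] , _ ∷ _ , () , _
... | _ ∷ _ ∷ _ ∷ _ ∷ _ ∷ _ , _ , () , _

cross-rotate : ∀ a u → Cross (a ∷ u) → Cross (u ++ [ a ])
cross-rotate a u (x , y , .a ∷ʳ h) = x , y , ++⁺ʳ [ a ] h
cross-rotate a u (x , y , refl ∷ h) = y , x , ++⁺ h (refl ∷ [])

noCross-pair : ∀ a → ¬ Cross (a ∷ a ∷ [])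
noCross-pair a (_ , _ , h) with length-mono-≤ h
... | s≤s (s≤s ())

-- Rotating a w a to w a a turns it into the concatenation of the disjoint crossing-free words w and a a.
noCross-enclose : ∀ a w → count a w ≡ 0 → ¬ Cross w → ¬ Cross (a ∷ w ++ [ a ])
noCross-enclose a w a∉w no-w cross =
  noCross-++ w (a ∷ a ∷ []) disjoint no-w (noCross-pair a)
    (subst Cross (++-assoc w [ a ] [ a ]) (cross-rotate a (w ++ [ a ]) cross))
  where
  disjoint : Disjoint w (a ∷ a ∷ [])
  disjoint x pos with x ≟ a
  ... | yes refl with subst (1 ≤_) a∉w pos
  ...   | ()
  disjoint x pos | no x≢a = trans (count-there [ a ] x≢a) (count-there [] x≢a)

noCross-⊆ : ∀ {xs ys} → xs ⊆ ys → ¬ Cross ys → ¬ Cross xs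
noCross-⊆ xs⊆ys no-cross (x , y , h) = no-cross (x , y , ⊆-trans h xs⊆ys)

EmbedsFrom : List ℕ → ℕ → List ℕ → Set
EmbedsFrom π m [] = ⊤
EmbedsFrom π m (x ∷ xs) =
  ∃[ i ] (m ≤ toℕ i × lookup π i ≡ x × EmbedsFrom π (suc (toℕ i)) xs)

EmbedsFrom-≤ : ∀ π {m m′} xs → m′ ≤ m → EmbedsFrom π m xs → EmbedsFrom π m′ xs
EmbedsFrom-≤ π [] _ _ = tt
EmbedsFrom-≤ π (x ∷ xs) m′≤m (i , m≤i , eq , rest) = i , ≤-trans m′≤m m≤i , eq , rest

EmbedsFrom-∷ : ∀ y π {m} xs → EmbedsFrom π m xs → EmbedsFrom (y ∷ π) (suc m) xs
EmbedsFrom-∷ y π [] _ = tt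
EmbedsFrom-∷ y π (x ∷ xs) (i , m≤i , eq , rest) =
  Fin.suc i , s≤s m≤i , eq , EmbedsFrom-∷ y π xs rest

⊆⇒EmbedsFrom : ∀ {xs π} → xs ⊆ π → EmbedsFrom π 0 xs
⊆⇒EmbedsFrom [] = tt
⊆⇒EmbedsFrom {xs} (y ∷ʳ h) = EmbedsFrom-≤ _ xs z≤n (EmbedsFrom-∷ y _ xs (⊆⇒EmbedsFrom h))
⊆⇒EmbedsFrom {_ ∷ xs} (refl ∷ h) = Fin.zero , z≤n , refl , EmbedsFrom-∷ _ _ xs (⊆⇒EmbedsFrom h)

lookup∷⊆drop : ∀ (π : List ℕ) (i : Fin (length π)) m {xs} → m ≤ toℕ i →
  xs ⊆ drop (suc (toℕ i)) π → lookup π i ∷ xs ⊆ drop m π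
lookup∷⊆drop (y ∷ π) Fin.zero zero z≤n h = refl ∷ h
lookup∷⊆drop (y ∷ π) (Fin.suc i) zero z≤n h = y ∷ʳ lookup∷⊆drop π i zero z≤n h
lookup∷⊆drop (y ∷ π) (Fin.suc i) (suc m) (s≤s m≤i) h = lookup∷⊆drop π i m m≤i h

EmbedsFrom⇒⊆drop : ∀ π m xs → EmbedsFrom π m xs → xs ⊆ drop m π
EmbedsFrom⇒⊆drop π m [] _ = minimum _
EmbedsFrom⇒⊆drop π m (x ∷ xs) (i , m≤i , refl , rest) =
  lookup∷⊆drop π i m m≤i (EmbedsFrom⇒⊆drop π _ xs rest)

¬Cross⇒NoCrossing : ∀ π → ¬ Cross π → NoCrossing π
¬Cross⇒NoCrossing π no-cross i j k l i<j j<k k<l πi≡πk πj≡πl =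
  no-cross (lookup π k , lookup π l , EmbedsFrom⇒⊆drop π 0 _ positions)
  where
  positions : EmbedsFrom π 0 (lookup π k ∷ lookup π l ∷ lookup π k ∷ lookup π l ∷ [])
  positions = i , z≤n , πi≡πk , j , i<j , πj≡πl , k , j<k , refl , l , k<l , refl , tt

NoCrossing⇒¬Cross : ∀ π → NoCrossing π → ¬ Cross π
NoCrossing⇒¬Cross π no-crossing (x , y , h) with ⊆⇒EmbedsFrom h
... | i , _ , πi≡x , j , i<j , πj≡y , k , j<k , πk≡x , l , k<l , πl≡y , tt =
  no-crossing i j k l i<j j<k k<l (trans πi≡x (sym πk≡x)) (trans πj≡y (sym πl≡y))

Distinct-labelsF-∷⁻ : ∀ a t cs → Distinct (labelsF ((a , t) ∷ cs)) →
  count a (φ t) ≡ 0 × Distinct (labels t) × Distinct (labelsF cs) ×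
  Disjoint (a ∷ φ t ++ [ a ]) (φF cs)
Distinct-labelsF-∷⁻ a t cs distinct with Distinct-++⁻ (a ∷ labels t) (labelsF cs) distinct
... | distinct-edge , distinct-cs , disjoint with Distinct-∷⁻ a (labels t) distinct-edge
...   | a∉t , distinct-t =
  trans (count-φ a t) (cong (2 *_) a∉t) , distinct-t , distinct-cs ,
  Disjoint-double {a ∷ labels t} {labelsF cs} {a ∷ φ t ++ [ a ]} {φF cs}
    (λ x → count-excursion x a t) (λ x → count-φF x cs) disjoint

mutual
  noCross-φ : ∀ T → Distinct (labels T) → ¬ Cross (φ T)
  noCross-φ (node cs) = noCross-φF cs

  noCross-φF : ∀ cs → Distinct (labelsF cs) → ¬ Cross (φF cs)
  noCross-φF [] _ (_ , _ , ())
  noCross-φF ((a , t) ∷ cs) distinct with Distinct-labelsF-∷⁻ a t cs distinct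
  ... | a∉φt , distinct-t , distinct-cs , disjoint =
    noCross-++ (a ∷ φ t ++ [ a ]) (φF cs) disjoint
      (noCross-enclose a (φ t) a∉φt (noCross-φ t distinct-t)) (noCross-φF cs distinct-cs)

adjDes-++-∷ : ∀ xs a ys → adjDes (xs ++ a ∷ ys) ≡ adjDes (xs ++ [ a ]) + adjDes (a ∷ ys)
adjDes-++-∷ [] a ys = refl
adjDes-++-∷ (x ∷ []) a ys = cong (_+ adjDes (a ∷ ys)) (sym (+-identityʳ _))
adjDes-++-∷ (x ∷ y ∷ r) a ys rewrite adjDes-++-∷ (y ∷ r) a ys =
  sym (+-assoc (if does (y <? x) then 1 else 0) (adjDes (y ∷ r ++ [ a ])) (adjDes (a ∷ ys)))

adjDes-0∷ : ∀ xs → adjDes (0 ∷ xs) ≡ adjDes xs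
adjDes-0∷ [] = refl
adjDes-0∷ (x ∷ xs) = refl

-- Each excursion a φ(t) a is cut off at its closing a: the excursion contributes cdes of its
-- top vertex plus, inductively, its subtree, while the walk outside it sees only the label a.
adjDes-φF : ∀ p ds s → adjDes (p ∷ φF ds ++ s) ≡ adjDes (p ∷ map proj₁ ds ++ s) + cdesF ds
adjDes-φF p [] s = sym (+-identityʳ _)
adjDes-φF p ((a , node es) ∷ ds) s = begin
  descent + adjDes (a ∷ ((φF es ++ [ a ]) ++ φF ds) ++ s)
    ≡⟨ cong (λ w → descent + adjDes (a ∷ w)) (reassociate (φF es) (φF ds)) ⟩
  descent + adjDes ((a ∷ φF es) ++ a ∷ (φF ds ++ s))
    ≡⟨ cong (descent +_) (adjDes-++-∷ (a ∷ φF es) a (φF ds ++ s)) ⟩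
  descent + (adjDes (a ∷ φF es ++ [ a ]) + adjDes (a ∷ φF ds ++ s))
    ≡⟨ cong₂ (λ e f → descent + (e + f)) (adjDes-φF a es [ a ]) (adjDes-φF a ds s) ⟩
  descent + ((cdes (a ∷ map proj₁ es) + cdesF es) + (adjDes (a ∷ map proj₁ ds ++ s) + cdesF ds))
    ≡⟨ rearrange descent (cdes (a ∷ map proj₁ es)) (cdesF es)
                 (adjDes (a ∷ map proj₁ ds ++ s)) (cdesF ds) ⟩
  descent + adjDes (a ∷ map proj₁ ds ++ s) + (cdes (a ∷ map proj₁ es) + cdesF es + cdesF ds) ∎
  where
  open ≡-Reasoning
  descent : ℕ
  descent = if does (a <? p) then 1 else 0
  reassociate : ∀ u v → ((u ++ [ a ]) ++ v) ++ s ≡ u ++ a ∷ (v ++ s)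
  reassociate u v = trans (++-assoc (u ++ [ a ]) v s) (++-assoc u [ a ] (v ++ s))
  rearrange : ∀ b c e d f → b + ((c + e) + (d + f)) ≡ b + d + (c + e + f)
  rearrange = solve-∀

-- A leading 0 adds no descent, so it can stand in for the missing parent label of the root.
des-φ : ∀ T → des (φ T) ≡ cdesT T
des-φ (node []) = refl
des-φ (node cs@(_ ∷ _)) = begin
  adjDes (φF cs) + 1
    ≡⟨ cong (_+ 1) (adjDes-0∷ (φF cs)) ⟨
  adjDes (0 ∷ φF cs) + 1
    ≡⟨ cong (λ w → adjDes (0 ∷ w) + 1) (++-identityʳ (φF cs)) ⟨
  adjDes (0 ∷ φF cs ++ []) + 1
    ≡⟨ cong (_+ 1) (adjDes-φF 0 cs []) ⟩
  adjDes (0 ∷ map proj₁ cs ++ []) + cdesF cs + 1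
    ≡⟨ cong (λ w → adjDes (0 ∷ w) + cdesF cs + 1) (++-identityʳ (map proj₁ cs)) ⟩
  adjDes (0 ∷ map proj₁ cs) + cdesF cs + 1
    ≡⟨ cong (λ d → d + cdesF cs + 1) (adjDes-0∷ (map proj₁ cs)) ⟩
  adjDes (map proj₁ cs) + cdesF cs + 1
    ≡⟨ rearrange (adjDes (map proj₁ cs)) (cdesF cs) ⟩
  adjDes (map proj₁ cs) + 1 + cdesF cs ∎
  where
  open ≡-Reasoning
  rearrange : ∀ d c → d + c + 1 ≡ d + 1 + c
  rearrange = solve-∀

split-at-first-unique : ∀ a {xs ys xs′ ys′} → count a xs ≡ 0 → count a xs′ ≡ 0 →
  xs ++ a ∷ ys ≡ xs′ ++ a ∷ ys′ → xs ≡ xs′ × ys ≡ ys′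
split-at-first-unique a {[]} {xs′ = []} _ _ eq = refl , ∷-injectiveʳ eq
split-at-first-unique a {[]} {xs′ = z ∷ xs′} _ a∉xs′ eq with ∷-injectiveˡ eq
... | refl with trans (sym (count-here a xs′)) a∉xs′
...   | ()
split-at-first-unique a {z ∷ xs} {xs′ = []} a∉xs _ eq with ∷-injectiveˡ eq
... | refl with trans (sym (count-here a xs)) a∉xs
...   | ()
split-at-first-unique a {z ∷ xs} {xs′ = z′ ∷ xs′} a∉xs a∉xs′ eq with ∷-injective eq
... | refl , eq′ with split-at-first-unique a (m+n≡0⇒n≡0 _ a∉xs) (m+n≡0⇒n≡0 _ a∉xs′) eq′
...   | refl , refl = refl , refl

mutual
  φ-injective : ∀ T T′ → Distinct (labels T) → Distinct (labels T′) → φ T ≡ φ T′ → T ≡ T′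
  φ-injective (node cs) (node cs′) distinct distinct′ eq =
    cong node (φF-injective cs cs′ distinct distinct′ eq)

  φF-injective : ∀ cs cs′ → Distinct (labelsF cs) → Distinct (labelsF cs′) →
    φF cs ≡ φF cs′ → cs ≡ cs′
  φF-injective [] [] _ _ _ = refl
  φF-injective ((a , t) ∷ cs) ((a′ , t′) ∷ cs′) distinct distinct′ eq with ∷-injective eq
  ... | refl , eq′
    with Distinct-labelsF-∷⁻ a t cs distinct | Distinct-labelsF-∷⁻ a t′ cs′ distinct′
  ... | a∉φt , distinct-t , distinct-cs , _ | a∉φt′ , distinct-t′ , distinct-cs′ , _
    with split-at-first-unique a a∉φt a∉φt′
           (trans (sym (++-assoc (φ t) [ a ] (φF cs))) (trans eq′ (++-assoc (φ t′) [ a ] (φF cs′))))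
  ... | φt≡φt′ , φFcs≡φFcs′ =
    cong₂ (λ u us → (a , u) ∷ us)
      (φ-injective t t′ distinct-t distinct-t′ φt≡φt′)
      (φF-injective cs cs′ distinct-cs distinct-cs′ φFcs≡φFcs′)

ZeroOrTwo : ℕ → Set
ZeroOrTwo c = c ≡ 0 ⊎ c ≡ 2

Paired : List ℕ → Set
Paired π = ∀ x → ZeroOrTwo (count x π)

ZeroOrTwo-+⁻ : ∀ m n → ZeroOrTwo (m + n) → m ≡ 0 ⊎ n ≡ 0 → ZeroOrTwo m × ZeroOrTwo n
ZeroOrTwo-+⁻ m n m+n∈ (inj₁ refl) = inj₁ refl , m+n∈
ZeroOrTwo-+⁻ m n m+n∈ (inj₂ refl) = subst ZeroOrTwo (+-identityʳ m) m+n∈ , inj₁ refl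

zero-or-positive : ∀ n → n ≡ 0 ⊎ 1 ≤ n
zero-or-positive zero = inj₁ refl
zero-or-positive (suc n) = inj₂ (s≤s z≤n)

Paired-double : ∀ {π L} → Distinct L → π ↭ double L → Paired π
Paired-double {π} {L} distinct p x
  with count x L | distinct x | trans (count-resp-↭ p x) (count-double x L)
... | zero | _ | e = inj₁ e
... | suc zero | _ | e = inj₂ e
... | suc (suc _) | s≤s () | _

Paired-head : ∀ a ρ → Paired (a ∷ ρ) → count a ρ ≡ 1
Paired-head a ρ paired with subst ZeroOrTwo (count-here a ρ) (paired a)
... | inj₂ e = suc-injective e

-- A letter occurring once between the two a's and once after them would form the crossing a x a x.
Paired-enclosed⁻ : ∀ a w v → count a w ≡ 0 →
  Paired (a ∷ w ++ a ∷ v) → ¬ Cross (a ∷ w ++ a ∷ v) → Paired w × Paired v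
Paired-enclosed⁻ a w v a∉w paired no-cross = proj₁ ∘ halves , proj₂ ∘ halves
  where
  count-a : count a (w ++ a ∷ v) ≡ suc (count a v)
  count-a = trans (count-++ a w (a ∷ v)) (cong₂ _+_ a∉w (count-here a v))
  a∉v : count a v ≡ 0
  a∉v = suc-injective (trans (sym count-a) (Paired-head a (w ++ a ∷ v) paired))
  count-x : ∀ {x} → x ≢ a → count x (a ∷ w ++ a ∷ v) ≡ count x w + count x v
  count-x {x} x≢a = trans (count-there (w ++ a ∷ v) x≢a)
    (trans (count-++ x w (a ∷ v)) (cong (count x w +_) (count-there v x≢a)))
  absent-on-one-side : ∀ x → count x w ≡ 0 ⊎ count x v ≡ 0
  absent-on-one-side x with zero-or-positive (count x w) | zero-or-positive (count x v)
  ... | inj₁ x∉w | _ = inj₁ x∉w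
  ... | inj₂ _ | inj₁ x∉v = inj₂ x∉v
  ... | inj₂ x∈w | inj₂ x∈v = ⊥-elim (no-cross (a , x ,
        refl ∷ ++⁺ (count-pos⇒[x]⊆ x w x∈w) (refl ∷ count-pos⇒[x]⊆ x v x∈v)))
  halves : ∀ x → ZeroOrTwo (count x w) × ZeroOrTwo (count x v)
  halves x with x ≟ a
  ... | yes refl = inj₁ a∉w , inj₁ a∉v
  ... | no x≢a = ZeroOrTwo-+⁻ _ _ (subst ZeroOrTwo (count-x x≢a) (paired x)) (absent-on-one-side x)

φF-surjective : ∀ k π → length π ≤ k → Paired π → ¬ Cross π → ∃[ cs ] φF cs ≡ π
φF-surjective _ [] _ _ _ = [] , refl
φF-surjective zero (_ ∷ _) () _ _
φF-surjective (suc k) (a ∷ ρ) (s≤s |ρ|≤k) paired no-cross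
  with split-at-first a ρ (subst (1 ≤_) (sym (Paired-head a ρ paired)) ≤-refl)
... | w , v , refl , a∉w =
  excursion (recurse w (++⁺ʳ (a ∷ v) ⊆-refl) paired-w)
            (recurse v (++⁺ˡ w (a ∷ʳ ⊆-refl)) paired-v)
  where
  paired-w : Paired w
  paired-w = proj₁ (Paired-enclosed⁻ a w v a∉w paired no-cross)
  paired-v : Paired v
  paired-v = proj₂ (Paired-enclosed⁻ a w v a∉w paired no-cross)
  recurse : ∀ u → u ⊆ w ++ a ∷ v → Paired u → ∃[ cs ] φF cs ≡ u
  recurse u u⊆ρ paired-u =
    φF-surjective k u (≤-trans (length-mono-≤ u⊆ρ) |ρ|≤k) paired-u
      (noCross-⊆ (a ∷ʳ u⊆ρ) no-cross)
  excursion : ∃[ es ] φF es ≡ w → ∃[ ds ] φF ds ≡ v → ∃[ cs ] φF cs ≡ a ∷ w ++ a ∷ v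
  excursion (es , refl) (ds , refl) =
    (a , node es) ∷ ds , cong (a ∷_) (++-assoc (φF es) [ a ] (φF ds))

labels-↭⇒φ-↭ : ∀ T {L} → labels T ↭ L → φ T ↭ double L
labels-↭⇒φ-↭ T {L} p = count-≡⇒↭ (φ T) (double L) λ x → begin
  count x (φ T)            ≡⟨ count-φ x T ⟩
  2 * count x (labels T)   ≡⟨ cong (2 *_) (count-resp-↭ p x) ⟩
  2 * count x L            ≡⟨ count-double x L ⟨
  count x (double L)       ∎
  where open ≡-Reasoning

φ-↭⇒labels-↭ : ∀ T {L} → φ T ↭ double L → labels T ↭ L
φ-↭⇒labels-↭ T {L} p = count-≡⇒↭ (labels T) L λ x → *-cancelˡ-≡ _ _ 2 (begin
  2 * count x (labels T)   ≡⟨ count-φ x T ⟨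
  count x (φ T)            ≡⟨ count-resp-↭ p x ⟩
  count x (double L)       ≡⟨ count-double x L ⟩
  2 * count x L            ∎)
  where open ≡-Reasoning

lemma2p1 : (n : ℕ) → 1 ≤ n →
    ((T : Tree) → InT n T → QuasiStirling n (φ T) × des (φ T) ≡ cdesT T)
    × ((T T′ : Tree) → InT n T → InT n T′ → φ T ≡ φ T′ → T ≡ T′)
    × ((π : List ℕ) → QuasiStirling n π → ∃[ T ] (InT n T × φ T ≡ π))
lemma2p1 n _ = φ-quasiStirling , φ-injective-on , φ-surjective-on
  where
  distinct : ∀ T → InT n T → Distinct (labels T)
  distinct T p = Distinct-resp-↭ p (Distinct-range n)

  φ-quasiStirling : (T : Tree) → InT n T → QuasiStirling n (φ T) × des (φ T) ≡ cdesT T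
  φ-quasiStirling T p =
    (labels-↭⇒φ-↭ T p , ¬Cross⇒NoCrossing (φ T) (noCross-φ T (distinct T p))) , des-φ T

  φ-injective-on : (T T′ : Tree) → InT n T → InT n T′ → φ T ≡ φ T′ → T ≡ T′
  φ-injective-on T T′ p p′ = φ-injective T T′ (distinct T p) (distinct T′ p′)

  φ-surjective-on : (π : List ℕ) → QuasiStirling n π → ∃[ T ] (InT n T × φ T ≡ π)
  φ-surjective-on π (p , no-crossing)
    with φF-surjective (length π) π ≤-refl (Paired-double {π} {range n} (Distinct-range n) p)
           (NoCrossing⇒¬Cross π no-crossing)
  ... | cs , refl = node cs , φ-↭⇒labels-↭ (node cs) p , refl
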